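{- Let $T$ be a tournament of order $n\geq 3$. If $T$ has an arc $(u, v)$ with $d^-_{T}(u)=0$ and $d^+_{T}(v)=0$, then $T$ has no $\overrightarrow{P_3}$-decomposition.
   Context: A tournament is an orientation of a complete graph. $d^-_T$ and $d^+_T$ denote in-degree and out-degree. A $\overrightarrow{P_{3}}$-decomposition of a digraph is a partition of its arc set into directed paths of length $2$ (each path $u\to v\to w$ with $u,v,w$ distinct). -}

module Defs where

open import Data.Nat using (ℕ)
open import Data.Bool using (Bool; true; false; T)
open import Data.Fin using (Fin)
open import Data.Fin.Properties using () renaming (_≟_ to _≟ᶠ_)
open import Data.List using (List; []; _∷_; concatMap; length; filter; allFin)
open import Data.List.Relation.Unary.All using (All)
open import Data.Product using (_×_; _,_; Σ)
open import Data.Sum using (_⊎_)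
open import Relation.Binary.PropositionalEquality using (_≡_)
open import Relation.Nullary using (¬_)

Digraph : ℕ → Set
Digraph n = Fin n → Fin n → Bool

record IsTournament {n : ℕ} (A : Digraph n) : Set where
  field
    irreflexive : ∀ x → A x x ≡ false
    total       : ∀ x y → ¬ (x ≡ y) → T (A x y) ⊎ T (A y x)
    antisym     : ∀ x y → T (A x y) → ¬ T (A y x)

outdeg : {n : ℕ} → Digraph n → Fin n → ℕ
outdeg {n} A x = length (filter (λ y → T? (A x y)) (allFin n))
  where open import Data.Bool.Properties using (T?)

indeg : {n : ℕ} → Digraph n → Fin n → ℕ
indeg {n} A y = length (filter (λ x → T? (A x y)) (allFin n))
  where open import Data.Bool.Properties using (T?)

record P3 (n : ℕ) : Set where
  constructor path
  field
    u v w : Fin n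

Arc : ℕ → Set
Arc n = Fin n × Fin n

arcsOf : {n : ℕ} → P3 n → List (Arc n)
arcsOf (path u v w) = (u , v) ∷ (v , w) ∷ []

Distinct3 : {n : ℕ} → P3 n → Set
Distinct3 (path u v w) = ¬ (u ≡ v) × ¬ (v ≡ w) × ¬ (u ≡ w)

countArc : {n : ℕ} → Arc n → List (Arc n) → ℕ
countArc a [] = 0
countArc (x , y) ((x' , y') ∷ as) with x ≟ᶠ x' | y ≟ᶠ y'
... | Relation.Nullary.yes _ | Relation.Nullary.yes _ = ℕ.suc (countArc (x , y) as)
... | _ | _ = countArc (x , y) as

arcIndicator : Bool → ℕ
arcIndicator true  = 1
arcIndicator false = 0

-- A P3-decomposition of A: a list of directed 2-paths with distinct vertices
-- whose arcs partition the arc set of A, i.e. every arc of A is used exactly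
-- once and every non-arc is used zero times.
record P3Decomposition {n : ℕ} (A : Digraph n) : Set where
  field
    paths     : List (P3 n)
    distinct  : All Distinct3 paths
    partition : ∀ x y → countArc (x , y) (concatMap arcsOf paths) ≡ arcIndicator (A x y)

module Submission where

-- In a P3-decomposition the arc (u , v) lies on some path x → y → z: either it is
-- the first arc, so v has the out-neighbour z, or it is the second arc, so u has
-- the in-neighbour x.

open import Defs
open import Data.Nat using (ℕ; _≥_)
open import Data.Nat.Properties using (<⇒≢)
open import Data.Fin using (Fin)
open import Data.Fin.Properties using () renaming (_≟_ to _≟ᶠ_)
open import Data.Bool using (true; false; T)
open import Data.Bool.Properties using (T?)
open import Data.Unit using (tt)
open import Data.List using (List; []; _∷_; concatMap)
open import Data.List.Membership.Propositional using (_∈_)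
open import Data.List.Membership.Propositional.Properties using (∈-allFin; ∈-filter⁺; ∈-length)
open import Data.List.Relation.Unary.Any using (here; there)
open import Data.Product using (∃; _,_; map₂)
open import Data.Sum using (_⊎_; inj₁; inj₂) renaming (map to map⊎)
open import Function using (_∘_)
open import Relation.Binary.PropositionalEquality using (_≡_; _≢_; refl; sym; subst)
open import Relation.Nullary using (¬_; yes; no)

module _ {n : ℕ} (A : Digraph n) where

  outdeg≡0⇒¬arc : ∀ {x y} → outdeg A x ≡ 0 → ¬ T (A x y)
  outdeg≡0⇒¬arc {x} {y} d xy =
    <⇒≢ (∈-length (∈-filter⁺ (λ z → T? (A x z)) (∈-allFin y) xy)) (sym d)

  indeg≡0⇒¬arc : ∀ {x y} → indeg A y ≡ 0 → ¬ T (A x y)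
  indeg≡0⇒¬arc {x} {y} d xy =
    <⇒≢ (∈-length (∈-filter⁺ (λ z → T? (A z y)) (∈-allFin x) xy)) (sym d)

countArc≢0⇒∈ : ∀ {n} {a : Arc n} {as : List (Arc n)} → countArc a as ≢ 0 → a ∈ as
countArc≢0⇒∈ {as = []} c≢0 with () ← c≢0 refl
countArc≢0⇒∈ {a = x , y} {as = (x′ , y′) ∷ as} c≢0 with x ≟ᶠ x′ | y ≟ᶠ y′
... | yes refl | yes refl = here refl
... | yes _    | no _     = there (countArc≢0⇒∈ c≢0)
... | no _     | _        = there (countArc≢0⇒∈ c≢0)

∈⇒countArc≢0 : ∀ {n} {a : Arc n} {as : List (Arc n)} → a ∈ as → countArc a as ≢ 0
∈⇒countArc≢0 {a = x , y} {as = (x′ , y′) ∷ as} a∈ with x ≟ᶠ x′ | y ≟ᶠ y′ | a∈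
... | yes _  | yes _  | _         = λ ()
... | no x≢  | _      | here refl = λ _ → x≢ refl
... | yes _  | no y≢  | here refl = λ _ → y≢ refl
... | no _   | _      | there a∈′ = ∈⇒countArc≢0 a∈′
... | yes _  | no _   | there a∈′ = ∈⇒countArc≢0 a∈′

T⇒arcIndicator≢0 : ∀ {b} → T b → arcIndicator b ≢ 0
T⇒arcIndicator≢0 {true} _ ()

arcIndicator≢0⇒T : ∀ {b} → arcIndicator b ≢ 0 → T b
arcIndicator≢0⇒T {true}  _   = tt
arcIndicator≢0⇒T {false} i≢0 with () ← i≢0 refl

arcs-successor-or-predecessor : ∀ {n} {x y : Fin n} (ps : List (P3 n)) →
  (x , y) ∈ concatMap arcsOf ps →
  (∃ λ z → (y , z) ∈ concatMap arcsOf ps) ⊎ (∃ λ z → (z , x) ∈ concatMap arcsOf ps)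
arcs-successor-or-predecessor (path a b c ∷ ps) (here refl)         = inj₁ (c , there (here refl))
arcs-successor-or-predecessor (path a b c ∷ ps) (there (here refl)) = inj₂ (a , here refl)
arcs-successor-or-predecessor (path a b c ∷ ps) (there (there xy∈)) =
  map⊎ (map₂ (there ∘ there)) (map₂ (there ∘ there)) (arcs-successor-or-predecessor ps xy∈)

module _ {n : ℕ} {A : Digraph n} (D : P3Decomposition A) where
  open P3Decomposition D

  arc⇒covered : ∀ {x y} → T (A x y) → (x , y) ∈ concatMap arcsOf paths
  arc⇒covered {x} {y} xy =
    countArc≢0⇒∈ (subst (_≢ 0) (sym (partition x y)) (T⇒arcIndicator≢0 xy))

  covered⇒arc : ∀ {x y} → (x , y) ∈ concatMap arcsOf paths → T (A x y)
  covered⇒arc {x} {y} xy∈ =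
    arcIndicator≢0⇒T (subst (_≢ 0) (partition x y) (∈⇒countArc≢0 xy∈))

corollary3p3 : (n : ℕ) → n ≥ 3 → (A : Digraph n) → IsTournament A →
    (u v : Fin n) → T (A u v) → indeg A u ≡ 0 → outdeg A v ≡ 0 →
    ¬ P3Decomposition A
corollary3p3 n _ A _ u v uv indeg-u≡0 outdeg-v≡0 D
  with arcs-successor-or-predecessor (P3Decomposition.paths D) (arc⇒covered D uv)
... | inj₁ (w , vw∈) = outdeg≡0⇒¬arc A outdeg-v≡0 (covered⇒arc D vw∈)
... | inj₂ (w , wu∈) = indeg≡0⇒¬arc A indeg-u≡0 (covered⇒arc D wu∈)
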